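{- Let $\pi$ be a feasible solution for the restricted instance $I'$ in which at most $1/\Delta$ risky jobs are rejected and whose cost is at most $(1+\frac{\epsilon}{2})Z^*(I)$ (such a $\pi$ exists, e.g. by keeping the rejection decisions and machine assignments of an optimal solution of $I$), and suppose $\pi$ is associated with the rejection type $(k_1, k_2, \ldots, k_{1/\delta})$, i.e., exactly $k_i$ jobs of $B_i$ are rejected in $\pi$ for every $i=1,\ldots,1/\delta$. Then there exists a feasible solution $\pi'$ for the restricted instance $I'$ such that: (1) $\pi'$ is associated with the same rejection type $(k_1, k_2, \ldots, k_{1/\delta})$ as $\pi$; (2) the cost of $\pi'$ is at most $(1+\frac{\epsilon}{2})Z^*(I)$; (3) in $\pi'$, the first $k_i$ jobs of $B_i$ (in the order of non-increasing processing times) are rejected, for every $i=1,\ldots,1/\delta$.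
   Context: Problem: $Pm \mid rej, U, r_i=r \mid C_{\max}(A)+\sum_{J_j\in R} e_j$. There are $n$ jobs $J_1,\ldots,J_n$ and a fixed number $m$ of identical machines; job $J_j$ has processing time $p_j$ and rejection penalty $e_j$. Each job is either rejected (paying $e_j$) or accepted and scheduled on a machine; the total processing time of accepted jobs must not exceed $U$ (feasibility). The cost of a feasible solution is the makespan of accepted jobs plus the total rejection penalty of rejected jobs; $Z^*(I)$ is the optimal cost of instance $I$. Fix $0<\epsilon<1$ with $1/\epsilon$ an integer. The instance $I$ is normalized (dividing all $p_j,e_j$ by the cost of a 2-approximate solution) so that $\frac12 \le Z^*(I) \le 1$. Set $\Delta = \frac{\epsilon}{4m+12}$ and $\delta = \frac{\epsilon\Delta}{2}$. A job is risky if $e_j \ge \Delta$, otherwise safe. The restricted instance $I'$ is obtained from $I$ by rounding the rejection penalty of each risky job up to the least multiple of $\delta$ (processing times unchanged; so $e'_j \le (1+\frac\epsilon2)e_j$). In $I'$, the risky jobs are partitioned into sets $B_i = \{J_j \text{ risky}: e_j = i\delta\}$, $i=1,\ldots,1/\delta$, and the jobs of each $B_i$ are sorted in non-increasing order of processing times. A rejection type is a $\frac1\delta$-tuple $(k_1,\ldots,k_{1/\delta})$ of non-negative integers with $\sum_i k_i \le 1/\Delta$; a feasible solution of $I'$ is associated with it if exactly $k_i$ jobs of $B_i$ are rejected, for every $i$. -}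

module Defs where

open import Data.Nat as ℕ using (ℕ; zero; suc; NonZero)
open import Data.Fin as F using (Fin; zero; suc)
open import Data.Integer using (ℤ; +_)
open import Data.Rational using (ℚ; 0ℚ; 1ℚ; _+_; _*_; _≤_; _⊔_; _/_; ceiling)
open import Data.Rational.Properties using (_≟_; _≤?_)
open import Data.Maybe using (Maybe; just; nothing)
open import Data.Bool using (Bool; true; false; _∧_; not; if_then_else_)
open import Data.List using (List)
open import Data.List.Membership.Propositional using (_∈_)
open import Data.List.Relation.Unary.Unique.Propositional using (Unique)
open import Data.List.Relation.Unary.Linked using (Linked)
open import Function.Bundles using (_⇔_)
open import Relation.Nullary using (does)
open import Data.Product using (Σ; _×_)
open import Relation.Binary.PropositionalEquality using (_≡_)

ΣF : ∀ {n} → (Fin n → ℚ) → ℚ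
ΣF {zero}  f = 0ℚ
ΣF {suc n} f = f zero + ΣF (λ i → f (suc i))

maxF : ∀ {n} → (Fin n → ℚ) → ℚ
maxF {zero}  f = 0ℚ
maxF {suc n} f = f zero ⊔ maxF (λ i → f (suc i))

countF : ∀ {n} → (Fin n → Bool) → ℕ
countF {zero}  f = 0
countF {suc n} f = (if f zero then 1 else 0) ℕ.+ countF (λ i → f (suc i))

-- an instance: processing times p, rejection penalties e, bound U
record Instance (n : ℕ) : Set where
  field
    p : Fin n → ℚ
    e : Fin n → ℚ
    U : ℚ
open Instance public

-- a solution: nothing = rejected, just k = accepted and run on machine k
Solution : ℕ → ℕ → Set
Solution n m = Fin n → Maybe (Fin m)

accepted : ∀ {m} → Maybe (Fin m) → Bool
accepted nothing  = false
accepted (just _) = true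

rejected : ∀ {m} → Maybe (Fin m) → Bool
rejected x = not (accepted x)

onMachine : ∀ {m} → Maybe (Fin m) → Fin m → Bool
onMachine nothing  k = false
onMachine (just k′) k = does (k′ F.≟ k)

load : ∀ {n m} → Instance n → Solution n m → Fin m → ℚ
load I π k = ΣF (λ j → if onMachine (π j) k then p I j else 0ℚ)

makespan : ∀ {n m} → Instance n → Solution n m → ℚ
makespan I π = maxF (load I π)

totalPenalty : ∀ {n m} → Instance n → Solution n m → ℚ
totalPenalty I π = ΣF (λ j → if rejected (π j) then e I j else 0ℚ)

cost : ∀ {n m} → Instance n → Solution n m → ℚ
cost I π = makespan I π + totalPenalty I π

Feasible : ∀ {n m} → Instance n → Solution n m → Set
Feasible I π = ΣF (λ j → if accepted (π j) then p I j else 0ℚ) ≤ U I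

IsOptimal : ∀ {n} (m : ℕ) → Instance n → ℚ → Set
IsOptimal {n} m I z =
  Σ (Solution n m) (λ π → Feasible I π × cost I π ≡ z)
  × ((π : Solution n m) → Feasible I π → z ≤ cost I π)

-- parameters; K = 1/ε (a positive integer)
ε : (K : ℕ) → .{{NonZero K}} → ℚ
ε K = + 1 / K

Δ : (m K : ℕ) → .{{NonZero K}} → ℚ
Δ m K = ε K * (+ 1 / (12 ℕ.+ 4 ℕ.* m))

δ : (m K : ℕ) → .{{NonZero K}} → ℚ
δ m K = (ε K * Δ m K) * (+ 1 / 2)

-- 1/δ as a natural number (= 2(4m+12)K²)
invδ : ℕ → ℕ → ℕ
invδ m K = 2 ℕ.* (12 ℕ.+ 4 ℕ.* m) ℕ.* K ℕ.* K

-- 1/Δ as a natural number (= (4m+12)K)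
invΔ : ℕ → ℕ → ℕ
invΔ m K = (12 ℕ.+ 4 ℕ.* m) ℕ.* K

risky : ∀ {n} (m K : ℕ) → .{{NonZero K}} → Instance n → Fin n → Bool
risky m K I j = does (Δ m K ≤? e I j)

-- rejection penalty in I': risky penalties rounded up to the least multiple of δ
-- (⌈ e_j / δ ⌉ · δ, computed as ⌈ e_j · (1/δ) ⌉ · δ)
roundedPenalty : ∀ {n} (m K : ℕ) → .{{NonZero K}} → Instance n → Fin n → ℚ
roundedPenalty m K I j =
  if risky m K I j
  then (ceiling (e I j * (+ invδ m K / 1)) / 1) * δ m K
  else e I j

restricted : ∀ {n} (m K : ℕ) → .{{NonZero K}} → Instance n → Instance n
restricted m K I = record { p = p I ; e = roundedPenalty m K I ; U = U I }

inB : ∀ {n} (m K : ℕ) → .{{NonZero K}} → Instance n → ℕ → Fin n → Bool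
inB m K I i j =
  risky m K I j ∧ does (roundedPenalty m K I j ≟ (+ i / 1) * δ m K)

SortedB : ∀ {n} (m K : ℕ) → .{{NonZero K}} → Instance n → ℕ → List (Fin n) → Set
SortedB m K I i L =
  Unique L
  × ((j : Fin _) → (j ∈ L) ⇔ (inB m K I i j ≡ true))
  × Linked (λ a b → p I b ≤ p I a) L

AssociatedWith : ∀ {n} (m K : ℕ) → .{{NonZero K}} → Instance n → Solution n m → (ℕ → ℕ) → Set
AssociatedWith m K I π k =
  (i : ℕ) → 1 ℕ.≤ i → i ℕ.≤ invδ m K →
  countF (λ j → inB m K I i j ∧ rejected (π j)) ≡ k i

-- If some job a among the first k_i jobs of B_i is accepted, then, since π
-- rejects exactly k_i jobs of B_i, some rejected job b of B_i lies after the first k_i, so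
-- p_b ≤ p_a. Swapping the fates of a and b (b runs on a's machine, a is rejected) keeps the
-- rejection type, because a and b have the same rounded penalty, and increases neither the
-- accepted work, nor any machine load, nor the total penalty. Every swap rejects one more job
-- of the prefixes, so finitely many swaps reach a solution rejecting all of them.
module Submission where

open import Defs
import Algebra.Properties.CommutativeMonoid.Sum as CommutativeMonoidSum
import Algebra.Properties.CommutativeSemigroup as CommutativeSemigroupProperties
open import Data.Bool using (Bool; true; false; _∧_; _∨_; if_then_else_)
import Data.Bool.Properties as BP
open import Data.Fin as F using (Fin; zero; suc)
import Data.Fin.Permutation as Permutation
open import Data.Fin.Permutation.Components using (transpose)
open import Data.Fin.Properties using (any?; all?; ¬∀⟶∃¬; toℕ<n; toℕ-fromℕ<)
open import Data.Integer using (+_)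
open import Data.List using (List; []; _∷_; length; take)
import Data.List.Properties as LP
open import Data.List.Membership.Propositional using (_∈_; _∉_; find)
open import Data.List.Relation.Binary.Sublist.Propositional using (lookup)
open import Data.List.Relation.Binary.Sublist.Propositional.Properties using (take-⊆)
open import Data.List.Relation.Unary.All as All using (All)
open import Data.List.Relation.Unary.All.Properties using (¬All⇒Any¬)
open import Data.List.Relation.Unary.AllPairs using (AllPairs; _∷_)
import Data.List.Relation.Unary.Any as Any
open import Data.List.Relation.Unary.Any using (here; there)
open import Data.List.Relation.Unary.Linked using (Linked)
open import Data.List.Relation.Unary.Linked.Properties using (Linked⇒AllPairs)
open import Data.List.Relation.Unary.Unique.Propositional using (Unique)
open import Data.Maybe using (Maybe; nothing)
open import Data.Nat as ℕ using (ℕ; zero; suc; z≤n; s≤s; NonZero)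
open import Data.Nat.Induction using (<-wellFounded)
import Data.Nat.Properties as ℕP
open import Data.Product using (Σ; ∃-syntax; _×_; _,_; proj₁; proj₂)
open import Data.Rational using (ℚ; 0ℚ; 1ℚ; _+_; _*_; _≤_; _/_; Positive)
import Data.Rational.Properties as QP
open import Data.Sum using (_⊎_; inj₁; inj₂)
open import Function.Base using (id; case_of_)
open import Function.Bundles using (Equivalence; _⇔_)
open import Induction.WellFounded using (Acc; acc)
open import Relation.Binary.PropositionalEquality
open import Relation.Nullary using (Dec; does; yes; no; ¬?; contradiction)
open import Relation.Nullary.Decidable using (dec-true; dec-false; decidable-stable; _×-dec_)

private
  module Σℚ = CommutativeMonoidSum QP.+-0-commutativeMonoid
  module Σℕ = CommutativeMonoidSum ℕP.+-0-commutativeMonoid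
  open CommutativeSemigroupProperties ℕP.+-commutativeSemigroup using () renaming (interchange to ℕ-interchange)

_∈?_ : ∀ {n} (j : Fin n) (xs : List (Fin n)) → Dec (j ∈ xs)
j ∈? xs = Any.any? (j F.≟_) xs

∀-transpose : ∀ {n} {Q : Fin n → Fin n → Set} (a b : Fin n) →
  Q a b → Q b a → (∀ j → Q j j) → ∀ j → Q j (transpose a b j)
∀-transpose a b Qab Qba Qjj j with j F.≟ a
... | yes refl = Qab
... | no _ with j F.≟ b
...   | yes refl = Qba
...   | no _ = Qjj j

ΣF≡sum : ∀ {n} (f : Fin n → ℚ) → ΣF f ≡ Σℚ.sum f
ΣF≡sum {zero}  f = refl
ΣF≡sum {suc n} f = cong (λ s → f zero + s) (ΣF≡sum (λ j → f (suc j)))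

ΣF-mono-≤ : ∀ {n} {f g : Fin n → ℚ} → (∀ j → f j ≤ g j) → ΣF f ≤ ΣF g
ΣF-mono-≤ {zero}  f≤g = QP.≤-refl
ΣF-mono-≤ {suc n} f≤g = QP.+-mono-≤ (f≤g zero) (ΣF-mono-≤ (λ j → f≤g (suc j)))

ΣF-transpose : ∀ {n} (f : Fin n → ℚ) (a b : Fin n) → ΣF (λ j → f (transpose a b j)) ≡ ΣF f
ΣF-transpose {n} f a b = begin
  ΣF (λ j → f (transpose a b j))     ≡⟨ ΣF≡sum (λ j → f (transpose a b j)) ⟩
  Σℚ.sum (λ j → f (transpose a b j)) ≡⟨ Σℚ.sum-permute {n} {n} f (Permutation.transpose a b) ⟨
  Σℚ.sum f                           ≡⟨ ΣF≡sum f ⟨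
  ΣF f                               ∎
  where open ≡-Reasoning

indicator : Bool → ℕ
indicator b = if b then 1 else 0

countF≡sum : ∀ {n} (f : Fin n → Bool) → countF f ≡ Σℕ.sum (λ j → indicator (f j))
countF≡sum {zero}  f = refl
countF≡sum {suc n} f = cong (indicator (f zero) ℕ.+_) (countF≡sum (λ j → f (suc j)))

countF-transpose : ∀ {n} (f : Fin n → Bool) (a b : Fin n) → countF (λ j → f (transpose a b j)) ≡ countF f
countF-transpose {n} f a b = begin
  countF (λ j → f (transpose a b j))                 ≡⟨ countF≡sum (λ j → f (transpose a b j)) ⟩
  Σℕ.sum (λ j → indicator (f (transpose a b j)))     ≡⟨ Σℕ.sum-permute {n} {n} (λ j → indicator (f j)) (Permutation.transpose a b) ⟨
  Σℕ.sum (λ j → indicator (f j))                     ≡⟨ countF≡sum f ⟨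
  countF f                                           ∎
  where open ≡-Reasoning

countF-cong : ∀ {n} {f g : Fin n → Bool} → (∀ j → f j ≡ g j) → countF f ≡ countF g
countF-cong {zero}  f≡g = refl
countF-cong {suc n} f≡g = cong₂ (λ x y → indicator x ℕ.+ y) (f≡g zero) (countF-cong (λ j → f≡g (suc j)))

indicator-mono : ∀ {x y} → (x ≡ true → y ≡ true) → indicator x ℕ.≤ indicator y
indicator-mono {false}         _   = z≤n
indicator-mono {true}  {true}  _   = ℕP.≤-refl
indicator-mono {true}  {false} x⇒y with () ← x⇒y refl

countF-mono-≤ : ∀ {n} {f g : Fin n → Bool} → (∀ j → f j ≡ true → g j ≡ true) → countF f ℕ.≤ countF g
countF-mono-≤ {zero}  f⊆g = z≤n
countF-mono-≤ {suc n} f⊆g = ℕP.+-mono-≤ (indicator-mono (f⊆g zero)) (countF-mono-≤ (λ j → f⊆g (suc j)))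

countF-mono-< : ∀ {n} {f g : Fin n → Bool} (a : Fin n) → (∀ j → f j ≡ true → g j ≡ true) →
  f a ≡ false → g a ≡ true → countF f ℕ.< countF g
countF-mono-< zero f⊆g fa ga rewrite fa | ga = s≤s (countF-mono-≤ (λ j → f⊆g (suc j)))
countF-mono-< (suc a) f⊆g fa ga =
  ℕP.+-mono-≤-< (indicator-mono (f⊆g zero)) (countF-mono-< a (λ j → f⊆g (suc j)) fa ga)

countF-false : ∀ {n} → countF {n} (λ _ → false) ≡ 0
countF-false {zero}  = refl
countF-false {suc n} = countF-false {n}

countF-≤ : ∀ {n} (f : Fin n → Bool) → countF f ℕ.≤ n
countF-≤ {zero}  f = z≤n
countF-≤ {suc n} f = ℕP.+-mono-≤ (indicator≤1 (f zero)) (countF-≤ (λ j → f (suc j)))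
  where
  indicator≤1 : ∀ x → indicator x ℕ.≤ 1
  indicator≤1 false = z≤n
  indicator≤1 true  = ℕP.≤-refl

countF-∨ : ∀ {n} (f g : Fin n → Bool) → countF (λ j → f j ∨ g j) ℕ.≤ countF f ℕ.+ countF g
countF-∨ {zero}  f g = z≤n
countF-∨ {suc n} f g = begin
  indicator (f zero ∨ g zero) ℕ.+ countF (λ j → f (suc j) ∨ g (suc j))
    ≤⟨ ℕP.+-mono-≤ (indicator-∨ (f zero) (g zero)) (countF-∨ (λ j → f (suc j)) (λ j → g (suc j))) ⟩
  (indicator (f zero) ℕ.+ indicator (g zero)) ℕ.+ (countF (λ j → f (suc j)) ℕ.+ countF (λ j → g (suc j)))
    ≡⟨ ℕ-interchange (indicator (f zero)) (indicator (g zero)) _ _ ⟩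
  countF f ℕ.+ countF g ∎
  where
  open ℕP.≤-Reasoning
  indicator-∨ : ∀ x y → indicator (x ∨ y) ℕ.≤ indicator x ℕ.+ indicator y
  indicator-∨ true  y = s≤s z≤n
  indicator-∨ false y = ℕP.≤-refl

countF-≟ : ∀ {n} (x : Fin n) → countF (λ j → does (j F.≟ x)) ≡ 1
countF-≟ {suc n} zero = cong suc (countF-false {n})
countF-≟ (suc x) = countF-≟ x

countF-∈-≤-length : ∀ {n} (xs : List (Fin n)) → countF (λ j → does (j ∈? xs)) ℕ.≤ length xs
countF-∈-≤-length {n} []       = ℕP.≤-reflexive (countF-false {n})
countF-∈-≤-length (x ∷ xs) = begin
  countF (λ j → does (j F.≟ x) ∨ does (j ∈? xs))
    ≤⟨ countF-∨ (λ j → does (j F.≟ x)) (λ j → does (j ∈? xs)) ⟩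
  countF (λ j → does (j F.≟ x)) ℕ.+ countF (λ j → does (j ∈? xs))
    ≤⟨ ℕP.+-mono-≤ (ℕP.≤-reflexive (countF-≟ x)) (countF-∈-≤-length xs) ⟩
  suc (length xs) ∎
  where open ℕP.≤-Reasoning

∧≡true⁻ : ∀ {x y} → x ∧ y ≡ true → x ≡ true × y ≡ true
∧≡true⁻ {true} {true} _ = refl , refl

rejected⇒nothing : ∀ {m} {o : Maybe (Fin m)} → rejected o ≡ true → o ≡ nothing
rejected⇒nothing {o = nothing} _ = refl

transpose-matchˡ : ∀ {n} (a b : Fin n) → transpose a b a ≡ b
transpose-matchˡ a b rewrite dec-true (a F.≟ a) refl = refl

ΣF-transpose-≤ : ∀ {n} (F : Fin n → Fin n → ℚ) (a b : Fin n) → F b a ≤ F b b → F a b ≤ F a a →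
  ΣF (λ j → F (transpose a b j) j) ≤ ΣF (λ j → F j j)
ΣF-transpose-≤ F a b Fba≤Fbb Fab≤Faa = QP.≤-trans
  (ΣF-mono-≤ (∀-transpose {Q = λ j s → F s j ≤ F s s} a b Fba≤Fbb Fab≤Faa (λ _ → QP.≤-refl)))
  (QP.≤-reflexive (ΣF-transpose (λ j → F j j) a b))

countF-transpose-≡ : ∀ {n} (f : Fin n → Fin n → Bool) (a b : Fin n) → f b a ≡ f b b → f a b ≡ f a a →
  countF (λ j → f (transpose a b j) j) ≡ countF (λ j → f j j)
countF-transpose-≡ f a b fba≡fbb fab≡faa = trans
  (countF-cong (∀-transpose {Q = λ j s → f s j ≡ f s s} a b fba≡fbb fab≡faa (λ _ → refl)))
  (countF-transpose (λ j → f j j) a b)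

maxF-mono-≤ : ∀ {n} {f g : Fin n → ℚ} → (∀ j → f j ≤ g j) → maxF f ≤ maxF g
maxF-mono-≤ {zero}  f≤g = QP.≤-refl
maxF-mono-≤ {suc n} f≤g = QP.⊔-mono-≤ (f≤g zero) (maxF-mono-≤ (λ j → f≤g (suc j)))

if-mono-≤ : ∀ (c : Bool) {x y : ℚ} → x ≤ y → (if c then x else 0ℚ) ≤ (if c then y else 0ℚ)
if-mono-≤ true  x≤y = x≤y
if-mono-≤ false _   = QP.≤-refl

swapJobs : ∀ {n m} → Fin n → Fin n → Solution n m → Solution n m
swapJobs a b π j = π (transpose a b j)

-- The disjunction serves both uses: b is unselected (accepted work, machine loads), or a and b
-- weigh the same (penalties).
selectedSum-swapJobs-≤ : ∀ {n m} (c : Maybe (Fin m) → Bool) (w : Fin n → ℚ) (π : Solution n m) {a b : Fin n} →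
  c (π b) ≡ false ⊎ w a ≤ w b → w b ≤ w a →
  ΣF (λ j → if c (swapJobs a b π j) then w j else 0ℚ) ≤ ΣF (λ j → if c (π j) then w j else 0ℚ)
selectedSum-swapJobs-≤ c w π {a} {b} bUnselected⊎wa≤wb wb≤wa =
  ΣF-transpose-≤ (λ s j → if c (π s) then w j else 0ℚ) a b (atA bUnselected⊎wa≤wb) (if-mono-≤ (c (π a)) wb≤wa)
  where
  atA : c (π b) ≡ false ⊎ w a ≤ w b → (if c (π b) then w a else 0ℚ) ≤ (if c (π b) then w b else 0ℚ)
  atA (inj₁ cb≡false) rewrite cb≡false = QP.≤-refl
  atA (inj₂ wa≤wb)                    = if-mono-≤ (c (π b)) wa≤wb

module _ {n m} (J : Instance n) (π : Solution n m) {a b : Fin n}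
  (πb≡nothing : π b ≡ nothing) (pb≤pa : p J b ≤ p J a) (eb≡ea : e J b ≡ e J a) where

  swapJobs-feasible : Feasible J π → Feasible J (swapJobs a b π)
  swapJobs-feasible = QP.≤-trans (selectedSum-swapJobs-≤ accepted (p J) π (inj₁ (cong accepted πb≡nothing)) pb≤pa)

  swapJobs-makespan-≤ : makespan J (swapJobs a b π) ≤ makespan J π
  swapJobs-makespan-≤ = maxF-mono-≤ λ k →
    selectedSum-swapJobs-≤ (λ o → onMachine o k) (p J) π (inj₁ (cong (λ o → onMachine o k) πb≡nothing)) pb≤pa

  swapJobs-totalPenalty-≤ : totalPenalty J (swapJobs a b π) ≤ totalPenalty J π
  swapJobs-totalPenalty-≤ =
    selectedSum-swapJobs-≤ rejected (e J) π (inj₂ (QP.≤-reflexive (sym eb≡ea))) (QP.≤-reflexive eb≡ea)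

  swapJobs-cost-≤ : cost J (swapJobs a b π) ≤ cost J π
  swapJobs-cost-≤ = QP.+-mono-≤ swapJobs-makespan-≤ swapJobs-totalPenalty-≤

countF-rejected-swapJobs : ∀ {n m} (P : Fin n → Bool) (π : Solution n m) {a b : Fin n} → P a ≡ P b →
  countF (λ j → P j ∧ rejected (swapJobs a b π j)) ≡ countF (λ j → P j ∧ rejected (π j))
countF-rejected-swapJobs P π {a} {b} Pa≡Pb = countF-transpose-≡ (λ s j → P j ∧ rejected (π s)) a b
  (cong (_∧ rejected (π b)) Pa≡Pb) (cong (_∧ rejected (π a)) (sym Pa≡Pb))

countF-rejected-swapJobs-< : ∀ {n m} (P : Fin n → Bool) (π : Solution n m) {a b : Fin n} →
  P a ≡ true → P b ≡ false → rejected (π a) ≡ false → π b ≡ nothing →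
  countF (λ j → P j ∧ rejected (π j)) ℕ.< countF (λ j → P j ∧ rejected (swapJobs a b π j))
countF-rejected-swapJobs-< P π {a} {b} Pa Pb πa-accepted πb≡nothing =
  countF-mono-< a (∀-transpose {Q = λ j s → P j ∧ rejected (π j) ≡ true → P j ∧ rejected (π s) ≡ true} a b
                     (λ _ → aRejected) bNotTarget (λ _ → id))
    (trans (cong (P a ∧_) πa-accepted) (BP.∧-zeroʳ (P a)))
    (trans (cong (λ s → P a ∧ rejected (π s)) (transpose-matchˡ a b)) aRejected)
  where
  aRejected : P a ∧ rejected (π b) ≡ true
  aRejected rewrite Pa | πb≡nothing = refl
  bNotTarget : P b ∧ rejected (π b) ≡ true → P b ∧ rejected (π a) ≡ true
  bNotTarget rewrite Pb = λ ()

AllPairs⇒take-related : ∀ {A : Set} {R : A → A → Set} {xs : List A} {a b : A} (k : ℕ) →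
  AllPairs R xs → a ∈ take k xs → b ∈ xs → b ∉ take k xs → R a b
AllPairs⇒take-related (suc k) (Rx ∷ _)   (here refl) (here refl) b∉ = contradiction (here refl) b∉
AllPairs⇒take-related (suc k) (Rx ∷ _)   (here refl) (there b∈) _  = All.lookup Rx b∈
AllPairs⇒take-related (suc k) (_  ∷ Rxs) (there a∈)  (here refl) b∉ = contradiction (here refl) b∉
AllPairs⇒take-related (suc k) (_  ∷ Rxs) (there a∈)  (there b∈) b∉ =
  AllPairs⇒take-related k Rxs a∈ b∈ (λ b∈′ → b∉ (there b∈′))

∃-outside-list : ∀ {n} (f : Fin n → Bool) (xs : List (Fin n)) {a : Fin n} →
  length xs ℕ.≤ countF f → a ∈ xs → f a ≡ false → ∃[ b ] f b ≡ true × b ∉ xs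
∃-outside-list f xs {a} len≤count a∈xs fa with any? (λ b → (f b BP.≟ true) ×-dec ¬? (b ∈? xs))
... | yes outsider = outsider
... | no  none     = contradiction len≤count (ℕP.<⇒≱ (begin-strict
  countF f                        <⟨ countF-mono-< a f⊆xs fa (dec-true (a ∈? xs) a∈xs) ⟩
  countF (λ j → does (j ∈? xs))   ≤⟨ countF-∈-≤-length xs ⟩
  length xs                       ∎))
  where
  open ℕP.≤-Reasoning
  f⊆xs : ∀ j → f j ≡ true → does (j ∈? xs) ≡ true
  f⊆xs j fj = dec-true (j ∈? xs) (decidable-stable (j ∈? xs) (λ j∉xs → none (j , fj , j∉xs)))

module _ {S : Set} (Good Done : S → Set) (μ : S → ℕ) (bound : ℕ) (μ≤bound : ∀ s → μ s ℕ.≤ bound)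
  (improve : ∀ s → Good s → Done s ⊎ Σ S (λ s′ → Good s′ × μ s ℕ.< μ s′)) where

  improve-until-done : ∀ s → Good s → Σ S (λ s′ → Good s′ × Done s′)
  improve-until-done s = go s (<-wellFounded (bound ℕ.∸ μ s))
    where
    go : ∀ s → Acc ℕ._<_ (bound ℕ.∸ μ s) → Good s → Σ S (λ s′ → Good s′ × Done s′)
    go s (acc rec) good with improve s good
    ... | inj₁ done               = s , good , done
    ... | inj₂ (s′ , good′ , μ<μ′) = go s′ (rec (ℕP.∸-monoʳ-< μ<μ′ (μ≤bound s′))) good′

module PenaltyClasses {n : ℕ} (eligible : Fin n → Bool) (w : Fin n → ℚ) (d : ℚ) .{{_ : Positive d}} where

  inClass : ℕ → Fin n → Bool
  inClass i j = eligible j ∧ does (w j QP.≟ (+ i / 1) * d)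

  multiple-injective : ∀ i i′ → (+ i / 1) * d ≡ (+ i′ / 1) * d → i ≡ i′
  multiple-injective i i′ id≡i′d = begin
    i        ≡⟨ ℕP.*-identityʳ i ⟨
    i ℕ.* 1  ≡⟨ QP.normalize-injective-≃ i i′ 1 1 i≡i′ ⟩
    i′ ℕ.* 1 ≡⟨ ℕP.*-identityʳ i′ ⟩
    i′       ∎
    where
    open ≡-Reasoning
    i≡i′ : + i / 1 ≡ + i′ / 1
    i≡i′ = QP.≤-antisym (QP.*-cancelʳ-≤-pos {+ i / 1} {+ i′ / 1} d (QP.≤-reflexive id≡i′d))
                        (QP.*-cancelʳ-≤-pos {+ i′ / 1} {+ i / 1} d (QP.≤-reflexive (sym id≡i′d)))

  inClass⇒eligible×penalty : ∀ i j → inClass i j ≡ true → eligible j ≡ true × w j ≡ (+ i / 1) * d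
  inClass⇒eligible×penalty i j j∈Bᵢ with eligible j | w j QP.≟ (+ i / 1) * d
  ... | true | yes wⱼ≡id = refl , wⱼ≡id

  inClass-unique : ∀ i i′ j → inClass i j ≡ true → inClass i′ j ≡ true → i ≡ i′
  inClass-unique i i′ j j∈Bᵢ j∈Bᵢ′ = multiple-injective i i′
    (trans (sym (proj₂ (inClass⇒eligible×penalty i j j∈Bᵢ))) (proj₂ (inClass⇒eligible×penalty i′ j j∈Bᵢ′)))

  inClass-same : ∀ i a b → inClass i a ≡ true → inClass i b ≡ true →
    w b ≡ w a × (∀ i′ → inClass i′ a ≡ inClass i′ b)
  inClass-same i a b a∈Bᵢ b∈Bᵢ =
    wb≡wa ,
    λ i′ → cong₂ (λ r v → r ∧ does (v QP.≟ (+ i′ / 1) * d)) (trans (proj₁ aFacts) (sym (proj₁ bFacts))) (sym wb≡wa)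
    where
    aFacts = inClass⇒eligible×penalty i a a∈Bᵢ
    bFacts = inClass⇒eligible×penalty i b b∈Bᵢ
    wb≡wa : w b ≡ w a
    wb≡wa = trans (proj₂ bFacts) (sym (proj₂ aFacts))

module PrefixExchange {n m : ℕ} (J : Instance n) (inClass : ℕ → Fin n → Bool)
  (inClass-unique : ∀ i i′ j → inClass i j ≡ true → inClass i′ j ≡ true → i ≡ i′)
  (inClass-same : ∀ i a b → inClass i a ≡ true → inClass i b ≡ true →
    e J b ≡ e J a × (∀ i′ → inClass i′ a ≡ inClass i′ b))
  (N : ℕ) (L : ℕ → List (Fin n))
  (sorted : ∀ i → 1 ℕ.≤ i → i ℕ.≤ N →
    Unique (L i) × (∀ j → (j ∈ L i) ⇔ (inClass i j ≡ true)) × Linked (λ a b → p J b ≤ p J a) (L i))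
  (k : ℕ → ℕ) (bound : ℚ) where

  HasRejectionType : Solution n m → Set
  HasRejectionType π = ∀ i → 1 ℕ.≤ i → i ℕ.≤ N → countF (λ j → inClass i j ∧ rejected (π j)) ≡ k i

  Admissible : Solution n m → Set
  Admissible π = Feasible J π × HasRejectionType π × cost J π ≤ bound

  prefix : ℕ → List (Fin n)
  prefix i = take (k i) (L i)

  PrefixesRejected : Solution n m → Set
  PrefixesRejected π = ∀ i → 1 ℕ.≤ i → i ℕ.≤ N → All (λ j → rejected (π j) ≡ true) (prefix i)

  class : Fin N → ℕ
  class c = suc (F.toℕ c)

  class-surjective : ∀ {i} → 1 ℕ.≤ i → i ℕ.≤ N → ∃[ c ] class c ≡ i
  class-surjective {suc i} _ i<N = F.fromℕ< i<N , cong suc (toℕ-fromℕ< i<N)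

  sortedClass : ∀ c → Unique (L (class c)) × (∀ j → (j ∈ L (class c)) ⇔ (inClass (class c) j ≡ true))
    × Linked (λ a b → p J b ≤ p J a) (L (class c))
  sortedClass c = sorted (class c) (s≤s z≤n) (toℕ<n c)

  members : ∀ c j → (j ∈ L (class c)) ⇔ (inClass (class c) j ≡ true)
  members c = proj₁ (proj₂ (sortedClass c))

  prefix⊆class : ∀ c {a} → a ∈ prefix (class c) → inClass (class c) a ≡ true
  prefix⊆class c {a} a∈prefix = Equivalence.to (members c a) (lookup (take-⊆ _ _) a∈prefix)

  prefix-dominates : ∀ c {a b} → a ∈ prefix (class c) → inClass (class c) b ≡ true → b ∉ prefix (class c) →
    p J b ≤ p J a
  prefix-dominates c {a} {b} a∈prefix b∈B b∉prefix = AllPairs⇒take-related (k (class c))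
    (Linked⇒AllPairs (λ pb≤pa pc≤pb → QP.≤-trans pc≤pb pb≤pa) (proj₂ (proj₂ (sortedClass c))))
    a∈prefix (Equivalence.from (members c b) b∈B) b∉prefix

  InPrefix : Fin n → Set
  InPrefix j = ∃[ c ] j ∈ prefix (class c)

  inPrefix? : (j : Fin n) → Dec (InPrefix j)
  inPrefix? j = any? (λ c → j ∈? prefix (class c))

  rejectedInPrefixes : Solution n m → ℕ
  rejectedInPrefixes π = countF (λ j → does (inPrefix? j) ∧ rejected (π j))

  prefixesRejected? : ∀ π → PrefixesRejected π ⊎ ∃[ c ] ∃[ a ] a ∈ prefix (class c) × rejected (π a) ≡ false
  prefixesRejected? π with all? (λ c → All.all? (λ j → rejected (π j) BP.≟ true) (prefix (class c)))
  ... | yes allRejected = inj₁ λ i 1≤i i≤N → case class-surjective 1≤i i≤N of λ { (c , refl) → allRejected c }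
  ... | no ¬allRejected with ¬∀⟶∃¬ _ _ (λ c → All.all? (λ j → rejected (π j) BP.≟ true) (prefix (class c))) ¬allRejected
  ...   | c , ¬cRejected with find (¬All⇒Any¬ (λ j → rejected (π j) BP.≟ true) _ ¬cRejected)
  ...     | a , a∈prefix , a-accepted = inj₂ (c , a , a∈prefix , BP.¬-not a-accepted)

  -- π rejects exactly k (class c) ≥ |prefix (class c)| jobs of the class but not the prefix job a,
  -- so one of them lies outside the prefix.
  rejected-outside-prefix : ∀ π → HasRejectionType π → ∀ c {a} → a ∈ prefix (class c) →
    rejected (π a) ≡ false → ∃[ b ] inClass (class c) b ≡ true × π b ≡ nothing × b ∉ prefix (class c)
  rejected-outside-prefix π hasType c {a} a∈prefix a-accepted =
    outside (∃-outside-list rejectedInClass (prefix (class c)) prefix≤count a∈prefix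
               (trans (cong (inClass (class c) a ∧_) a-accepted) (BP.∧-zeroʳ _)))
    where
    rejectedInClass : Fin n → Bool
    rejectedInClass j = inClass (class c) j ∧ rejected (π j)
    prefix≤count : length (prefix (class c)) ℕ.≤ countF rejectedInClass
    prefix≤count = begin
      length (prefix (class c))             ≡⟨ LP.length-take (k (class c)) (L (class c)) ⟩
      k (class c) ℕ.⊓ length (L (class c)) ≤⟨ ℕP.m⊓n≤m _ _ ⟩
      k (class c)                           ≡⟨ hasType (class c) (s≤s z≤n) (toℕ<n c) ⟨
      countF rejectedInClass                ∎
      where open ℕP.≤-Reasoning
    outside : ∃[ b ] rejectedInClass b ≡ true × b ∉ prefix (class c) →
      ∃[ b ] inClass (class c) b ≡ true × π b ≡ nothing × b ∉ prefix (class c)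
    outside (b , b∈B∧rejected , b∉prefix) with b∈B , b-rejected ← ∧≡true⁻ b∈B∧rejected =
      b , b∈B , rejected⇒nothing b-rejected , b∉prefix

  ∉prefix⇒¬inPrefix : ∀ c {b} → inClass (class c) b ≡ true → b ∉ prefix (class c) → does (inPrefix? b) ≡ false
  ∉prefix⇒¬inPrefix c {b} b∈B b∉prefix = dec-false (inPrefix? b) λ (c′ , b∈prefix′) →
    b∉prefix (subst (λ i → b ∈ prefix i) (inClass-unique (class c′) (class c) b (prefix⊆class c′ b∈prefix′) b∈B) b∈prefix′)

  exchange-step : ∀ π → Admissible π → ∀ c {a} → a ∈ prefix (class c) → rejected (π a) ≡ false →
    Σ (Solution n m) (λ π′ → Admissible π′ × rejectedInPrefixes π ℕ.< rejectedInPrefixes π′)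
  exchange-step π (feasible , hasType , cost≤bound) c {a} a∈prefix a-accepted
    with b , b∈B , πb≡nothing , b∉prefix ← rejected-outside-prefix π hasType c a∈prefix a-accepted
    with eb≡ea , sameClasses ← inClass-same (class c) a b (prefix⊆class c a∈prefix) b∈B
    with pb≤pa ← prefix-dominates c a∈prefix b∈B b∉prefix =
    swapJobs a b π ,
    ( swapJobs-feasible J π {a} {b} πb≡nothing pb≤pa eb≡ea feasible
    , (λ i 1≤i i≤N → trans (countF-rejected-swapJobs (inClass i) π {a} {b} (sameClasses i)) (hasType i 1≤i i≤N))
    , QP.≤-trans (swapJobs-cost-≤ J π {a} {b} πb≡nothing pb≤pa eb≡ea) cost≤bound ) ,
    countF-rejected-swapJobs-< (λ j → does (inPrefix? j)) π {a} {b}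
      (dec-true (inPrefix? a) (c , a∈prefix)) (∉prefix⇒¬inPrefix c b∈B b∉prefix) a-accepted πb≡nothing

  reject-prefixes : ∀ π → Admissible π → Σ (Solution n m) (λ π′ → Admissible π′ × PrefixesRejected π′)
  reject-prefixes = improve-until-done Admissible PrefixesRejected rejectedInPrefixes n (λ π → countF-≤ _) improve
    where
    improve : ∀ π → Admissible π →
      PrefixesRejected π ⊎ Σ (Solution n m) (λ π′ → Admissible π′ × rejectedInPrefixes π ℕ.< rejectedInPrefixes π′)
    improve π admissible with prefixesRejected? π
    ... | inj₁ done                            = inj₁ done
    ... | inj₂ (c , a , a∈prefix , a-accepted) = inj₂ (exchange-step π admissible c a∈prefix a-accepted)

δ-positive : ∀ m K .{{_ : NonZero K}} → Positive (δ m K)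
δ-positive m K = QP.pos*pos⇒pos (ε K * Δ m K) {{ε*Δ-positive}} (+ 1 / 2) {{QP.normalize-pos 1 2}}
  where
  ε-positive : Positive (ε K)
  ε-positive = QP.normalize-pos 1 K
  ε*Δ-positive : Positive (ε K * Δ m K)
  ε*Δ-positive = QP.pos*pos⇒pos (ε K) {{ε-positive}} (Δ m K)
    {{QP.pos*pos⇒pos (ε K) {{ε-positive}} (+ 1 / (12 ℕ.+ 4 ℕ.* m)) {{QP.normalize-pos 1 (12 ℕ.+ 4 ℕ.* m)}}}}

lemma6 : {n : ℕ} (m K : ℕ) .{{_ : NonZero K}} → 1 ℕ.≤ m → 2 ℕ.≤ K →
    (I : Instance n) → ((j : Fin n) → 0ℚ ≤ p I j) → ((j : Fin n) → 0ℚ ≤ e I j) →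
    (z : ℚ) → IsOptimal m I z → (+ 1 / 2) ≤ z → z ≤ 1ℚ →
    (L : ℕ → List (Fin n)) →
    ((i : ℕ) → 1 ℕ.≤ i → i ℕ.≤ invδ m K → SortedB m K I i (L i)) →
    (π : Solution n m) → Feasible (restricted m K I) π →
    countF (λ j → risky m K I j ∧ rejected (π j)) ℕ.≤ invΔ m K →
    cost (restricted m K I) π ≤ (1ℚ + ε K * (+ 1 / 2)) * z →
    (k : ℕ → ℕ) → AssociatedWith m K I π k →
    Σ (Solution n m) (λ π′ →
      Feasible (restricted m K I) π′
      × AssociatedWith m K I π′ k
      × cost (restricted m K I) π′ ≤ (1ℚ + ε K * (+ 1 / 2)) * z
      × ((i : ℕ) → 1 ℕ.≤ i → i ℕ.≤ invδ m K →
           All (λ j → rejected (π′ j) ≡ true) (take (k i) (L i))))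
-- The exchanges never increase the cost.
lemma6 m K _ _ I _ _ z _ _ _ L sorted π feasible _ cost≤ k associated =
  let π′ , (feasible′ , associated′ , cost′≤) , prefixesRejected =
        PrefixExchange.reject-prefixes (restricted m K I) (inB m K I) inClass-unique inClass-same
          (invδ m K) L sorted k ((1ℚ + ε K * (+ 1 / 2)) * z) π (feasible , associated , cost≤)
  in π′ , feasible′ , associated′ , cost′≤ , prefixesRejected
  where open PenaltyClasses (risky m K I) (roundedPenalty m K I) (δ m K) {{δ-positive m K}}
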